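{- Let $G$ be a connected $4$-regular graph of order $n$. Then $G$ is simply balanceable if and only if $n\equiv 0\pmod 4$.
   Context: All graphs are finite, simple and undirected. A graph $G=(V,E)$ is simply balanceable if there exists an independent set $I$ in $G$ such that $\lfloor |E|/2\rfloor \le \sum_{x\in I} d(x) \le \lceil |E|/2\rceil$, where $d(x)$ is the degree of $x$. -}

module Defs where

open import Data.Nat.Base using (ℕ; _+_; _<_; ⌊_/2⌋; ⌈_/2⌉; _≤_)
open import Data.Bool.Base using (Bool; true; false; if_then_else_)
open import Data.Fin.Base using (Fin; toℕ)
open import Data.Fin.Subset using (Subset; _∈_)
open import Data.List.Base using (List; map; allFin; concatMap)
open import Data.Nat.ListAction using (sum)
open import Relation.Binary.PropositionalEquality using (_≡_)
open import Relation.Binary.Construct.Closure.ReflexiveTransitive using (Star)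
open import Relation.Nullary using (¬_)
open import Relation.Nullary.Decidable using (⌊_⌋)
open import Data.Nat.Properties using (_<?_)
open import Data.Product using (_×_)

record Graph (n : ℕ) : Set where
  field
    adj    : Fin n → Fin n → Bool
    sym    : ∀ i j → adj i j ≡ adj j i
    irrefl : ∀ i → adj i i ≡ false

open Graph public

[_] : Bool → ℕ
[ b ] = if b then 1 else 0

degree : ∀ {n} → Graph n → Fin n → ℕ
degree {n} G x = sum (map (λ y → [ adj G x y ]) (allFin n))

edgeCount : ∀ {n} → Graph n → ℕ
edgeCount {n} G =
  sum (concatMap (λ i → map (λ j → [ ⌊ toℕ i <? toℕ j ⌋ ]
                                   * [ adj G i j ]) (allFin n)) (allFin n))
  where open import Data.Nat.Base using (_*_)

Adjacent : ∀ {n} → Graph n → Fin n → Fin n → Set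
Adjacent G x y = adj G x y ≡ true

Regular : ∀ {n} → ℕ → Graph n → Set
Regular {n} k G = ∀ (x : Fin n) → degree G x ≡ k

Connected : ∀ {n} → Graph n → Set
Connected {n} G = ∀ (x y : Fin n) → Star (Adjacent G) x y

Independent : ∀ {n} → Graph n → Subset n → Set
Independent {n} G I = ∀ (x y : Fin n) → x ∈ I → y ∈ I → ¬ Adjacent G x y

degreeSum : ∀ {n} → Graph n → Subset n → ℕ
degreeSum {n} G I = sum (map (λ x → if Data.Vec.Base.lookup I x then degree G x else 0) (allFin n))
  where import Data.Vec.Base

SimplyBalanceable : ∀ {n} → Graph n → Set
SimplyBalanceable {n} G =
  Σ (Subset n) λ I → Independent G I
                   × ⌊ edgeCount G /2⌋ ≤ degreeSum G I
                   × degreeSum G I ≤ ⌈ edgeCount G /2⌉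
  where open import Data.Product using (Σ)

-- With 4-regularity the degree sum of an independent set I is 4|I| and |E| = 2n, so both
-- balance bounds equal n: G is simply balanceable iff it has an independent set with
-- exactly n/4 vertices.  For connected G with n = 4k such a set is built greedily from a
-- candidate set S that misses a fixed vertex w.  Connectivity gives an edge y y′ with
-- y ∈ S and y′ ∉ S, so the closed neighbourhood N[y] meets S in at most 4 vertices (y′ is
-- one of the 5 but lies outside S); choose y and replace S by S ∖ N[y].  Starting from
-- V ∖ {w}, with 4k − 1 vertices, this can be done k times.
module Submission where

open import Defs
open import Data.Nat.Base using (ℕ; _%_)
open import Relation.Binary.PropositionalEquality using (_≡_)
open import Function.Bundles using (_⇔_)

open import Data.Bool.Base using (Bool; true; false; if_then_else_)
open import Data.Fin.Base using (Fin; zero; suc; toℕ)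
open import Data.Fin.Properties using (toℕ-injective)
open import Data.Fin.Subset
  using (Subset; inside; outside; _∈_; _∉_; _⊆_; ⁅_⁆; ∁; _∩_; _∪_; ∣_∣; Nonempty; Empty; ⊥)
open import Data.Fin.Subset.Properties
open import Data.List.Base using (List; []; _∷_; map; allFin; tabulate; concatMap)
open import Data.List.Properties using (map-tabulate)
open import Data.Nat.Base using (zero; suc; _+_; _*_; _∸_; _≤_; _<_; z≤n; s≤s; s≤s⁻¹; ⌊_/2⌋; ⌈_/2⌉)
open import Data.Nat.Divisibility using (_∣_; divides; m%n≡0⇔n∣m)
open import Data.Nat.ListAction using (sum)
open import Data.Nat.ListAction.Properties using (sum-++)
open import Data.Nat.Properties
open import Algebra.Properties.Semiring.Sum +-*-semiring
  using (sum-syntax; sum-cong-≗; ∑-distrib-+; ∑-comm; *-distribʳ-sum)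
open import Data.Nat.Tactic.RingSolver using (solve-∀)
open import Data.Product using (∃; ∃₂; _×_; _,_; proj₁; proj₂)
open import Data.Sum using (inj₁; inj₂)
open import Data.Vec.Base as Vec using ([]; _∷_; lookup)
open import Data.Vec.Properties using (lookup∘tabulate; lookup⇒[]=)
open import Function.Base using (_∘_)
open import Function.Bundles using (mk⇔)
open import Function.Construct.Composition using (_⇔-∘_)
open import Function.Construct.Symmetry using (⇔-sym)
open import Relation.Binary.Construct.Closure.ReflexiveTransitive using (Star; ε; _◅_)
open import Relation.Binary.PropositionalEquality
  using (refl; trans; cong; cong₂; subst; subst₂; module ≡-Reasoning)
  renaming (sym to ≡-sym)
open import Relation.Nullary using (yes; no; ¬_; contradiction)
open import Relation.Nullary.Decidable using (⌊_⌋)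

variable
  n : ℕ

∣p∣≡∣p∩q∣+∣p∩∁q∣ : (p q : Subset n) → ∣ p ∣ ≡ ∣ p ∩ q ∣ + ∣ p ∩ ∁ q ∣
∣p∣≡∣p∩q∣+∣p∩∁q∣ []            []            = refl
∣p∣≡∣p∩q∣+∣p∩∁q∣ (inside  ∷ p) (inside  ∷ q) = cong suc (∣p∣≡∣p∩q∣+∣p∩∁q∣ p q)
∣p∣≡∣p∩q∣+∣p∩∁q∣ (inside  ∷ p) (outside ∷ q) =
  trans (cong suc (∣p∣≡∣p∩q∣+∣p∩∁q∣ p q)) (≡-sym (+-suc _ _))
∣p∣≡∣p∩q∣+∣p∩∁q∣ (outside ∷ p) (_       ∷ q) = ∣p∣≡∣p∩q∣+∣p∩∁q∣ p q

∣p∪q∣+∣p∩q∣≡∣p∣+∣q∣ : (p q : Subset n) → ∣ p ∪ q ∣ + ∣ p ∩ q ∣ ≡ ∣ p ∣ + ∣ q ∣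
∣p∪q∣+∣p∩q∣≡∣p∣+∣q∣ []            []            = refl
∣p∪q∣+∣p∩q∣≡∣p∣+∣q∣ (inside  ∷ p) (inside  ∷ q) = begin
  suc (∣ p ∪ q ∣ + suc ∣ p ∩ q ∣) ≡⟨ cong suc (+-suc _ _) ⟩
  suc (suc (∣ p ∪ q ∣ + ∣ p ∩ q ∣)) ≡⟨ cong (2 +_) (∣p∪q∣+∣p∩q∣≡∣p∣+∣q∣ p q) ⟩
  suc (suc (∣ p ∣ + ∣ q ∣)) ≡⟨ cong suc (+-suc _ _) ⟨
  suc (∣ p ∣ + suc ∣ q ∣) ∎
  where open ≡-Reasoning
∣p∪q∣+∣p∩q∣≡∣p∣+∣q∣ (inside  ∷ p) (outside ∷ q) = cong suc (∣p∪q∣+∣p∩q∣≡∣p∣+∣q∣ p q)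
∣p∪q∣+∣p∩q∣≡∣p∣+∣q∣ (outside ∷ p) (inside  ∷ q) =
  trans (cong suc (∣p∪q∣+∣p∩q∣≡∣p∣+∣q∣ p q)) (≡-sym (+-suc _ _))
∣p∪q∣+∣p∩q∣≡∣p∣+∣q∣ (outside ∷ p) (outside ∷ q) = ∣p∪q∣+∣p∩q∣≡∣p∣+∣q∣ p q

∣p∪q∣≤∣p∣+∣q∣ : (p q : Subset n) → ∣ p ∪ q ∣ ≤ ∣ p ∣ + ∣ q ∣
∣p∪q∣≤∣p∣+∣q∣ p q = subst (∣ p ∪ q ∣ ≤_) (∣p∪q∣+∣p∩q∣≡∣p∣+∣q∣ p q) (m≤m+n _ _)

Empty⇒∣p∣≡0 : {p : Subset n} → Empty p → ∣ p ∣ ≡ 0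
Empty⇒∣p∣≡0 {n} empty = trans (cong ∣_∣ (Empty-unique empty)) (∣⊥∣≡0 n)

∣p∪q∣≡∣p∣+∣q∣ : (p q : Subset n) → Empty (p ∩ q) → ∣ p ∪ q ∣ ≡ ∣ p ∣ + ∣ q ∣
∣p∪q∣≡∣p∣+∣q∣ p q disjoint = begin
  ∣ p ∪ q ∣             ≡⟨ +-identityʳ _ ⟨
  ∣ p ∪ q ∣ + 0         ≡⟨ cong (∣ p ∪ q ∣ +_) (Empty⇒∣p∣≡0 disjoint) ⟨
  ∣ p ∪ q ∣ + ∣ p ∩ q ∣ ≡⟨ ∣p∪q∣+∣p∩q∣≡∣p∣+∣q∣ p q ⟩
  ∣ p ∣ + ∣ q ∣         ∎
  where open ≡-Reasoning

∣p∩q∣<∣q∣ : ∀ {x} (p q : Subset n) → x ∈ q → x ∉ p → ∣ p ∩ q ∣ < ∣ q ∣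
∣p∩q∣<∣q∣ p q x∈q x∉p = p⊂q⇒∣p∣<∣q∣ (p∩q⊆q p q , _ , x∈q , x∉p ∘ proj₁ ∘ x∈p∩q⁻ p q)

∣p∣>0⇒Nonempty : (p : Subset n) → 0 < ∣ p ∣ → Nonempty p
∣p∣>0⇒Nonempty p ∣p∣>0 with nonempty? p
... | yes nonempty = nonempty
... | no  empty    = contradiction (Empty⇒∣p∣≡0 empty) (>⇒≢ ∣p∣>0)

sum-tabulate : (f : Fin n → ℕ) → sum (tabulate f) ≡ ∑[ i < n ] f i
sum-tabulate {zero}  f = refl
sum-tabulate {suc n} f = cong (f zero +_) (sum-tabulate (f ∘ suc))

sum-map-allFin : (f : Fin n → ℕ) → sum (map f (allFin n)) ≡ ∑[ i < n ] f i
sum-map-allFin f = trans (cong sum (map-tabulate (λ i → i) f)) (sum-tabulate f)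

sum-concatMap : ∀ {A : Set} (f : A → List ℕ) (xs : List A) →
                sum (concatMap f xs) ≡ sum (map (sum ∘ f) xs)
sum-concatMap f []       = refl
sum-concatMap f (x ∷ xs) =
  trans (sum-++ (f x) (concatMap f xs)) (cong (sum (f x) +_) (sum-concatMap f xs))

∑-lookup : (p : Subset n) → ∑[ i < n ] [ lookup p i ] ≡ ∣ p ∣
∑-lookup []            = refl
∑-lookup (inside  ∷ p) = cong suc (∑-lookup p)
∑-lookup (outside ∷ p) = ∑-lookup p

∑-const : ∀ k → ∑[ i < n ] k ≡ n * k
∑-const {zero}  k = refl
∑-const {suc n} k = cong (k +_) (∑-const {n} k)

module _ {n} (G : Graph n) where

  Adjacent-sym : ∀ {x y} → Adjacent G x y → Adjacent G y x
  Adjacent-sym {x} {y} x~y = trans (Graph.sym G y x) x~y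

  Adjacent-irrefl : ∀ {x} → ¬ Adjacent G x x
  Adjacent-irrefl {x} x~x = contradiction (trans (≡-sym x~x) (irrefl G x)) λ ()

  neighbours : Fin n → Subset n
  neighbours x = Vec.tabulate (adj G x)

  ∈-neighbours⁺ : ∀ {x y} → Adjacent G x y → y ∈ neighbours x
  ∈-neighbours⁺ {x} {y} x~y = lookup⇒[]= y _ (trans (lookup∘tabulate (adj G x) y) x~y)

  ∣neighbours∣≡degree : ∀ x → ∣ neighbours x ∣ ≡ degree G x
  ∣neighbours∣≡degree x = begin
    ∣ neighbours x ∣                          ≡⟨ ∑-lookup (neighbours x) ⟨
    ∑[ y < n ] [ lookup (neighbours x) y ]    ≡⟨ sum-cong-≗ (cong [_] ∘ lookup∘tabulate (adj G x)) ⟩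
    ∑[ y < n ] [ adj G x y ]                  ≡⟨ sum-map-allFin (λ y → [ adj G x y ]) ⟨
    degree G x                                ∎
    where open ≡-Reasoning

  degreeSum-regular : ∀ {k} → Regular k G → (I : Subset n) → degreeSum G I ≡ ∣ I ∣ * k
  degreeSum-regular {k} regular I = begin
    degreeSum G I                        ≡⟨ sum-map-allFin (λ x → weight (lookup I x) x) ⟩
    ∑[ x < n ] weight (lookup I x) x     ≡⟨ sum-cong-≗ (λ x → weight≡ (lookup I x) x) ⟩
    ∑[ x < n ] ([ lookup I x ] * k)      ≡⟨ *-distribʳ-sum k (λ x → [ lookup I x ]) ⟨
    (∑[ x < n ] [ lookup I x ]) * k      ≡⟨ cong (_* k) (∑-lookup I) ⟩
    ∣ I ∣ * k                            ∎
    where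
    open ≡-Reasoning
    weight : Bool → Fin n → ℕ
    weight b x = if b then degree G x else 0
    weight≡ : ∀ b x → weight b x ≡ [ b ] * k
    weight≡ true  x = trans (regular x) (≡-sym (+-identityʳ k))
    weight≡ false x = refl

  orderedEdge : Fin n → Fin n → ℕ
  orderedEdge i j = [ ⌊ toℕ i <? toℕ j ⌋ ] * [ adj G i j ]

  orderedEdge-+ : ∀ i j → orderedEdge i j + orderedEdge j i ≡ [ adj G i j ]
  orderedEdge-+ i j rewrite Graph.sym G j i with toℕ i <? toℕ j | toℕ j <? toℕ i
  ... | yes i<j | yes j<i = contradiction j<i (<-asym i<j)
  ... | yes _   | no _    = trans (+-identityʳ _) (*-identityˡ _)
  ... | no _    | yes _   = *-identityˡ _
  ... | no i≮j  | no j≮i  = cong [_] (≡-sym (subst (λ k → adj G i k ≡ false) i≡j (irrefl G i)))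
    where
    i≡j : i ≡ j
    i≡j = toℕ-injective (≤-antisym (≮⇒≥ j≮i) (≮⇒≥ i≮j))

  edgeCount≡∑∑ : edgeCount G ≡ ∑[ i < n ] ∑[ j < n ] orderedEdge i j
  edgeCount≡∑∑ = begin
    edgeCount G                                      ≡⟨ sum-concatMap _ (allFin n) ⟩
    sum (map (λ i → sum (row i)) (allFin n))         ≡⟨ sum-map-allFin (λ i → sum (row i)) ⟩
    ∑[ i < n ] sum (row i)                           ≡⟨ sum-cong-≗ (λ i → sum-map-allFin (orderedEdge i)) ⟩
    ∑[ i < n ] ∑[ j < n ] orderedEdge i j            ∎
    where
    open ≡-Reasoning
    row : Fin n → List ℕ
    row i = map (orderedEdge i) (allFin n)

  handshake : edgeCount G + edgeCount G ≡ ∑[ i < n ] degree G i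
  handshake = begin
    edgeCount G + edgeCount G
      ≡⟨ cong₂ _+_ edgeCount≡∑∑ (trans edgeCount≡∑∑ (∑-comm orderedEdge)) ⟩
    ∑[ i < n ] ∑[ j < n ] orderedEdge i j + ∑[ i < n ] ∑[ j < n ] orderedEdge j i
      ≡⟨ ∑-distrib-+ (λ i → ∑[ j < n ] orderedEdge i j) (λ i → ∑[ j < n ] orderedEdge j i) ⟨
    ∑[ i < n ] (∑[ j < n ] orderedEdge i j + ∑[ j < n ] orderedEdge j i)
      ≡⟨ sum-cong-≗ (λ i → ∑-distrib-+ (orderedEdge i) (λ j → orderedEdge j i)) ⟨
    ∑[ i < n ] ∑[ j < n ] (orderedEdge i j + orderedEdge j i)
      ≡⟨ sum-cong-≗ (λ i → sum-cong-≗ (orderedEdge-+ i)) ⟩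
    ∑[ i < n ] ∑[ j < n ] [ adj G i j ]
      ≡⟨ sum-cong-≗ (λ i → sum-map-allFin (λ j → [ adj G i j ])) ⟨
    ∑[ i < n ] degree G i
      ∎
    where open ≡-Reasoning

  edgeCount-regular : ∀ {k} → Regular k G → edgeCount G + edgeCount G ≡ n * k
  edgeCount-regular {k} regular = trans handshake (trans (sum-cong-≗ regular) (∑-const {n} k))

  N[_] : Fin n → Subset n
  N[ y ] = ⁅ y ⁆ ∪ neighbours y

  edge-leaving : ∀ S {x w} → Star (Adjacent G) x w → x ∈ S → w ∉ S →
                 ∃₂ λ y y′ → y ∈ S × y′ ∉ S × Adjacent G y y′
  edge-leaving S ε                       x∈S w∉S = contradiction x∈S w∉S
  edge-leaving S (_◅_ {j = z} x~z z⇝w) x∈S w∉S with z ∈? S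
  ... | yes z∈S = edge-leaving S z⇝w z∈S w∉S
  ... | no  z∉S = _ , z , x∈S , z∉S , x~z

  Independent-⊥ : Independent G ⊥
  Independent-⊥ x _ x∈⊥ = contradiction x∈⊥ ∉⊥

  Independent-insert : ∀ {y I} → Independent G I → (∀ {x} → x ∈ I → ¬ Adjacent G y x) →
                       Independent G (⁅ y ⁆ ∪ I)
  Independent-insert {y} {I} independent y≁I a b a∈ b∈ a~b
    with x∈p∪q⁻ ⁅ y ⁆ I a∈ | x∈p∪q⁻ ⁅ y ⁆ I b∈
  ... | inj₁ a∈⁅y⁆ | inj₁ b∈⁅y⁆ =
    Adjacent-irrefl (subst₂ (Adjacent G) (x∈⁅y⁆⇒x≡y y a∈⁅y⁆) (x∈⁅y⁆⇒x≡y y b∈⁅y⁆) a~b)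
  ... | inj₁ a∈⁅y⁆ | inj₂ b∈I = y≁I b∈I (subst (λ a → Adjacent G a b) (x∈⁅y⁆⇒x≡y y a∈⁅y⁆) a~b)
  ... | inj₂ a∈I | inj₁ b∈⁅y⁆ = y≁I a∈I (Adjacent-sym (subst (Adjacent G a) (x∈⁅y⁆⇒x≡y y b∈⁅y⁆) a~b))
  ... | inj₂ a∈I | inj₂ b∈I = independent a b a∈I b∈I a~b

  IndependentSubset : Subset n → ℕ → Set
  IndependentSubset S m = ∃ λ I → I ⊆ S × Independent G I × ∣ I ∣ ≡ m

  IndependentSubset-insert : ∀ {S y m} → y ∈ S → IndependentSubset (S ∩ ∁ N[ y ]) m →
                             IndependentSubset S (suc m)
  IndependentSubset-insert {S} {y} y∈S (I , I⊆S∖N[y] , independent , ∣I∣≡m) =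
    ⁅ y ⁆ ∪ I , ⁅y⁆∪I⊆S , Independent-insert independent y≁I ,
    trans (∣p∪q∣≡∣p∣+∣q∣ ⁅ y ⁆ I disjoint) (cong₂ _+_ (∣⁅x⁆∣≡1 y) ∣I∣≡m)
    where
    ∉N[y] : ∀ {x} → x ∈ I → x ∉ N[ y ]
    ∉N[y] x∈I = x∈∁p⇒x∉p (proj₂ (x∈p∩q⁻ S _ (I⊆S∖N[y] x∈I)))
    y≁I : ∀ {x} → x ∈ I → ¬ Adjacent G y x
    y≁I x∈I = ∉N[y] x∈I ∘ q⊆p∪q ⁅ y ⁆ _ ∘ ∈-neighbours⁺
    disjoint : Empty (⁅ y ⁆ ∩ I)
    disjoint (x , x∈) with x∈p∩q⁻ ⁅ y ⁆ I x∈
    ... | x∈⁅y⁆ , x∈I = ∉N[y] x∈I (p⊆p∪q (neighbours y) x∈⁅y⁆)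
    ⁅y⁆∪I⊆S : ⁅ y ⁆ ∪ I ⊆ S
    ⁅y⁆∪I⊆S x∈ with x∈p∪q⁻ ⁅ y ⁆ I x∈
    ... | inj₁ x∈⁅y⁆ = subst (_∈ S) (≡-sym (x∈⁅y⁆⇒x≡y y x∈⁅y⁆)) y∈S
    ... | inj₂ x∈I   = proj₁ (x∈p∩q⁻ S _ (I⊆S∖N[y] x∈I))

  module _ {Δ} (degree≤Δ : ∀ x → degree G x ≤ Δ) where

    ∣N[y]∣≤1+Δ : ∀ y → ∣ N[ y ] ∣ ≤ suc Δ
    ∣N[y]∣≤1+Δ y = begin
      ∣ ⁅ y ⁆ ∪ neighbours y ∣      ≤⟨ ∣p∪q∣≤∣p∣+∣q∣ ⁅ y ⁆ (neighbours y) ⟩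
      ∣ ⁅ y ⁆ ∣ + ∣ neighbours y ∣  ≡⟨ cong₂ _+_ (∣⁅x⁆∣≡1 y) (∣neighbours∣≡degree y) ⟩
      suc (degree G y)              ≤⟨ s≤s (degree≤Δ y) ⟩
      suc Δ                         ∎
      where open ≤-Reasoning

    ∣S∣≤∣S∖N[y]∣+Δ : ∀ S {y y′} → Adjacent G y y′ → y′ ∉ S → ∣ S ∣ ≤ ∣ S ∩ ∁ N[ y ] ∣ + Δ
    ∣S∣≤∣S∖N[y]∣+Δ S {y} {y′} y~y′ y′∉S = begin
      ∣ S ∣                              ≡⟨ ∣p∣≡∣p∩q∣+∣p∩∁q∣ S N[ y ] ⟩
      ∣ S ∩ N[ y ] ∣ + ∣ S ∩ ∁ N[ y ] ∣  ≡⟨ +-comm ∣ S ∩ N[ y ] ∣ _ ⟩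
      ∣ S ∩ ∁ N[ y ] ∣ + ∣ S ∩ N[ y ] ∣  ≤⟨ +-monoʳ-≤ _ ∣S∩N[y]∣≤Δ ⟩
      ∣ S ∩ ∁ N[ y ] ∣ + Δ               ∎
      where
      open ≤-Reasoning
      y′∈N[y] : y′ ∈ N[ y ]
      y′∈N[y] = q⊆p∪q ⁅ y ⁆ _ (∈-neighbours⁺ y~y′)
      ∣S∩N[y]∣≤Δ : ∣ S ∩ N[ y ] ∣ ≤ Δ
      ∣S∩N[y]∣≤Δ = s≤s⁻¹ (≤-trans (∣p∩q∣<∣q∣ S N[ y ] y′∈N[y] y′∉S) (∣N[y]∣≤1+Δ y))

    -- Δ * m < ∣ S ∣ + Δ is ∣ S ∣ > Δ (m − 1) without truncated subtraction.
    independentSubset : Connected G → ∀ m S {w} → w ∉ S → Δ * m < ∣ S ∣ + Δ →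
                        IndependentSubset S m
    independentSubset _ zero S _ _ = ⊥ , ⊥⊆ , Independent-⊥ , ∣⊥∣≡0 n
    independentSubset connected (suc m) S {w} w∉S Δ[1+m]<∣S∣+Δ =
      grow (+-cancelʳ-< Δ (Δ * m) ∣ S ∣ Δm+Δ<∣S∣+Δ)
      where
      Δm+Δ<∣S∣+Δ : Δ * m + Δ < ∣ S ∣ + Δ
      Δm+Δ<∣S∣+Δ = subst (_< ∣ S ∣ + Δ) (trans (*-suc Δ m) (+-comm Δ (Δ * m))) Δ[1+m]<∣S∣+Δ
      grow : Δ * m < ∣ S ∣ → IndependentSubset S (suc m)
      grow Δm<∣S∣ with ∣p∣>0⇒Nonempty S (≤-<-trans z≤n Δm<∣S∣)
      ... | x , x∈S with edge-leaving S (connected x w) x∈S w∉S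
      ... | y , y′ , y∈S , y′∉S , y~y′ =
        IndependentSubset-insert y∈S
          (independentSubset connected m (S ∩ ∁ N[ y ]) (w∉S ∘ proj₁ ∘ x∈p∩q⁻ S _)
            (<-≤-trans Δm<∣S∣ (∣S∣≤∣S∖N[y]∣+Δ S y~y′ y′∉S)))

independentSet : ∀ {n Δ m} (G : Graph (suc n)) → Connected G → (∀ x → degree G x ≤ Δ) →
                 Δ * m < n + Δ → ∃ λ I → Independent G I × ∣ I ∣ ≡ m
independentSet {n} {Δ} {m} G connected degree≤Δ Δm<n+Δ =
  let I , _ , independent , ∣I∣≡m = independentSubset G degree≤Δ connected m S w∉S Δm<∣S∣+Δ
  in  I , independent , ∣I∣≡m
  where
  w : Fin (suc n)
  w = zero
  S : Subset (suc n)
  S = ∁ ⁅ w ⁆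
  w∉S : w ∉ S
  w∉S = x∈p⇒x∉∁p (x∈⁅x⁆ w)
  ∣S∣≡n : ∣ S ∣ ≡ n
  ∣S∣≡n = trans (∣∁p∣≡n∸∣p∣ ⁅ w ⁆) (cong (suc n ∸_) (∣⁅x⁆∣≡1 w))
  Δm<∣S∣+Δ : Δ * m < ∣ S ∣ + Δ
  Δm<∣S∣+Δ = subst (λ s → Δ * m < s + Δ) (≡-sym ∣S∣≡n) Δm<n+Δ

independentSet-quarter : ∀ {n k} (G : Graph n) → Connected G → Regular 4 G → n ≡ k * 4 →
                         ∃ λ I → Independent G I × ∣ I ∣ ≡ k
independentSet-quarter {zero}  {zero} G _ _ _ = ⊥ , Independent-⊥ G , ∣⊥∣≡0 0
independentSet-quarter {suc n} {k}    G connected regular n≡4k =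
  independentSet G connected (≤-reflexive ∘ regular) 4k<n+4
  where
  4k<n+4 : 4 * k < n + 4
  4k<n+4 = begin-strict
    4 * k  ≡⟨ *-comm 4 k ⟩
    k * 4  ≡⟨ n≡4k ⟨
    suc n  <⟨ s≤s (s≤s (m≤n+m n 2)) ⟩
    4 + n  ≡⟨ +-comm 4 n ⟩
    n + 4  ∎
    where open ≤-Reasoning

m+m≡n+n⇒m≡n : ∀ {m n} → m + m ≡ n + n → m ≡ n
m+m≡n+n⇒m≡n {m} {n} eq = trans (n≡⌊n+n/2⌋ m) (trans (cong ⌊_/2⌋ eq) (≡-sym (n≡⌊n+n/2⌋ n)))

n*4≡[n+n]+[n+n] : ∀ n → n * 4 ≡ (n + n) + (n + n)
n*4≡[n+n]+[n+n] = solve-∀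

simplyBalanceable⇔ : ∀ {n} {G : Graph n} → Regular 4 G →
                     SimplyBalanceable G ⇔ (∃ λ I → Independent G I × ∣ I ∣ * 4 ≡ n)
simplyBalanceable⇔ {n} {G} regular = mk⇔
  (λ (I , independent , lo , hi) → I , independent ,
     ≤-antisym (subst₂ _≤_ (degreeSum≡ I) ⌈E/2⌉≡n hi) (subst₂ _≤_ ⌊E/2⌋≡n (degreeSum≡ I) lo))
  (λ (I , independent , ∣I∣*4≡n) → I , independent ,
     ≤-reflexive (trans ⌊E/2⌋≡n (≡-sym (trans (degreeSum≡ I) ∣I∣*4≡n))) ,
     ≤-reflexive (trans (trans (degreeSum≡ I) ∣I∣*4≡n) (≡-sym ⌈E/2⌉≡n)))
  where
  degreeSum≡ : ∀ I → degreeSum G I ≡ ∣ I ∣ * 4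
  degreeSum≡ = degreeSum-regular G regular
  E≡n+n : edgeCount G ≡ n + n
  E≡n+n = m+m≡n+n⇒m≡n (trans (edgeCount-regular G regular) (n*4≡[n+n]+[n+n] n))
  ⌊E/2⌋≡n : ⌊ edgeCount G /2⌋ ≡ n
  ⌊E/2⌋≡n = trans (cong ⌊_/2⌋ E≡n+n) (≡-sym (n≡⌊n+n/2⌋ n))
  ⌈E/2⌉≡n : ⌈ edgeCount G /2⌉ ≡ n
  ⌈E/2⌉≡n = trans (cong ⌈_/2⌉ E≡n+n) (≡-sym (n≡⌈n+n/2⌉ n))

corollary3p6 : ∀ (n : ℕ) (G : Graph n) → Connected G → Regular 4 G →
                 (SimplyBalanceable G ⇔ (n % 4 ≡ 0))
corollary3p6 n G connected regular =
  ⇔-sym (m%n≡0⇔n∣m n 4) ⇔-∘ (independentQuarter⇔4∣n ⇔-∘ simplyBalanceable⇔ {G = G} regular)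
  where
  independentQuarter⇔4∣n : (∃ λ I → Independent G I × ∣ I ∣ * 4 ≡ n) ⇔ 4 ∣ n
  independentQuarter⇔4∣n = mk⇔
    (λ (I , _ , ∣I∣*4≡n) → divides ∣ I ∣ (≡-sym ∣I∣*4≡n))
    (λ (divides k n≡k*4) →
       let I , independent , ∣I∣≡k = independentSet-quarter {k = k} G connected regular n≡k*4
       in  I , independent , trans (cong (_* 4) ∣I∣≡k) (≡-sym n≡k*4))
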